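{- (Reflexivity.) For every predicate $P$ of system $\mathsf{MAV1}$, $\vdash \overline{P}\mathbin{\|}P$ holds, i.e. $\vdash P\multimap P$.
   Context: System $\mathsf{MAV1}$. Terms: $t ::= x \mid c \mid f\,t_1\cdots t_n$. Atoms: $\alpha ::= p\,t_1\cdots t_n$. Predicates: $P ::= \alpha \mid \overline{\alpha} \mid \circ \mid \forall x.P \mid \exists x.P \mid \mathsf{new}\,x.P \mid \mathsf{wen}\,x.P \mid P \mathbin{\&} P \mid P \oplus P \mid P \mathbin{\|} P \mid P \otimes P \mid P \mathbin{;} P$ (unit $\circ$). Quantifiers bind $x$; $\alpha$-conversion and capture-avoiding substitution $P\{v/x\}$ are standard; $x\#P$ means $x$ not free in $P$. Linear negation: $\overline{\overline{\alpha}}=\alpha$, $\overline{\circ}=\circ$, $\overline{P\otimes Q}=\overline P \| \overline Q$, $\overline{P\|Q}=\overline P\otimes\overline Q$, $\overline{P\oplus Q}=\overline P\&\overline Q$, $\overline{P\& Q}=\overline P\oplus\overline Q$, $\overline{P;Q}=\overline P;\overline Q$, $\overline{\forall x.P}=\exists x.\overline P$, $\overline{\exists x.P}=\forall x.\overline P$, $\overline{\mathsf{new}\,x.P}=\mathsf{wen}\,x.\overline P$, $\overline{\mathsf{wen}\,x.P}=\mathsf{new}\,x.\overline P$. $P\multimap Q$ is $\overline P\|Q$. Structural congruence $\equiv$: least congruence with $\alpha$-conversion, $(\|,\circ)$, $(\otimes,\circ)$ commutative monoids, $(;,\circ)$ a monoid, $\mathsf{new}\,x.\mathsf{new}\,y.P\equiv\mathsf{new}\,y.\mathsf{new}\,x.P$,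 $\mathsf{wen}\,x.\mathsf{wen}\,y.P\equiv\mathsf{wen}\,y.\mathsf{wen}\,x.P$. Contexts: $C\{\ \} ::= \{\cdot\} \mid C\{\ \}\odot P \mid P\odot C\{\ \} \mid \mathsf{Q}x.C\{\ \}$, $\odot\in\{;,\|,\otimes,\&,\oplus\}$, $\mathsf{Q}\in\{\forall,\exists,\mathsf{new},\mathsf{wen}\}$. Rules $L\longrightarrow R$ applied as $C\{L\}\longrightarrow C\{R\}$ in any context modulo $\equiv$: atomic interaction $\overline\alpha\|\alpha\to\circ$; switch $P\|(Q\otimes S)\to(P\|Q)\otimes S$; sequence $(P;Q)\|(U;V)\to(P\|U);(Q\|V)$; external $(P\&Q)\|S\to(P\|S)\&(Q\|S)$; tidy $\circ\&\circ\to\circ$; medial $(P;Q)\&(U;V)\to(P\&U);(Q\&V)$; left $P\oplus Q\to P$; right $P\oplus Q\to Q$; extrude1 $\forall x.P\|R\to\forall x.(P\|R)$; tidy1 $\forall x.\circ\to\circ$; medial1 $\forall x.(P;S)\to\forall x.P;\forall x.S$; select1 $\exists x.P\to P\{v/x\}$ ($v$ any term); close $\mathsf{new}\,x.P\|\mathsf{wen}\,x.Q\to\mathsf{new}\,x.(P\|Q)$; new wen $\mathsf{new}\,x.\mathsf{wen}\,y.P\to\mathsf{wen}\,y.\mathsf{new}\,x.P$; tidy name $\mathsf{new}\,x.\circ\to\circ$; extrude new $\mathsf{new}\,x.P\|R\to\mathsf{new}\,x.(P\|R)$; fresh $\mathsf{wen}\,x.P\to\mathsf{new}\,x.P$; medial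 new $\mathsf{new}\,x.(P;S)\to\mathsf{new}\,x.P;\mathsf{new}\,x.S$; for $\odot\in\{\|,;\}$: medial wen $\mathsf{wen}\,x.P\odot\mathsf{wen}\,x.S\to\mathsf{wen}\,x.(P\odot S)$, left wen $\mathsf{wen}\,x.P\odot R\to\mathsf{wen}\,x.(P\odot R)$, right wen $R\odot\mathsf{wen}\,x.Q\to\mathsf{wen}\,x.(R\odot Q)$; for $\mathsf{Q}\in\{\mathsf{new},\mathsf{wen}\}$: all name $\forall x.\mathsf{Q}y.P\to\mathsf{Q}y.\forall x.P$, with name $\mathsf{Q}x.P\&\mathsf{Q}x.S\to\mathsf{Q}x.(P\&S)$, left name $\mathsf{Q}x.P\&R\to\mathsf{Q}x.(P\&R)$, right name $R\&\mathsf{Q}x.Q\to\mathsf{Q}x.(R\&Q)$. In every rule containing $R$, $x\#R$. Restrictions: in switch, sequence, medial1, medial new, extrude new the displayed components are not $\equiv\circ$; in medial not both $P,U\equiv\circ$ and not both $Q,V\equiv\circ$; in external, extrude1, extrude new, left wen, right wen the side predicate is not $\equiv\circ$. A derivation is a finite sequence of rewrite steps interleaved with $\equiv$; a proof of $P$ is a derivation $P\longrightarrow\circ$; $\vdash P$ means $P$ has a proof. -}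

module Defs where

open import Data.Nat using (ℕ; zero; suc)
open import Data.List using (List; []; _∷_)
open import Data.Product using (_×_)
open import Relation.Nullary using (¬_)

-- Syntax of MAV1, with variables as de Bruijn indices (ℕ).
-- α-conversion is thereby built in (α-equivalent predicates are equal).
-- Constant, function and predicate symbols are drawn from ℕ.

data Term : Set where
  var : ℕ → Term
  con : ℕ → Term
  fun : ℕ → List Term → Term

data Atom : Set where
  atom : ℕ → List Term → Atom

infixr 4 _⊗_ _∥_ _&_ _⊕_
infixr 5 _⨾_

data Pred : Set where
  pos  : Atom → Pred
  neg  : Atom → Pred
  ∘    : Pred
  all  : Pred → Pred
  ex   : Pred → Pred
  new  : Pred → Pred
  wen  : Pred → Pred
  _&_  : Pred → Pred → Pred
  _⊕_  : Pred → Pred → Pred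
  _∥_  : Pred → Pred → Pred
  _⊗_  : Pred → Pred → Pred
  _⨾_  : Pred → Pred → Pred

dual : Pred → Pred
dual (pos a) = neg a
dual (neg a) = pos a
dual ∘ = ∘
dual (all P) = ex (dual P)
dual (ex P) = all (dual P)
dual (new P) = wen (dual P)
dual (wen P) = new (dual P)
dual (P & Q) = dual P ⊕ dual Q
dual (P ⊕ Q) = dual P & dual Q
dual (P ∥ Q) = dual P ⊗ dual Q
dual (P ⊗ Q) = dual P ∥ dual Q
dual (P ⨾ Q) = dual P ⨾ dual Q

_⊸_ : Pred → Pred → Pred
P ⊸ Q = dual P ∥ Q

ext : (ℕ → ℕ) → ℕ → ℕ
ext ρ zero = zero
ext ρ (suc n) = suc (ρ n)

mutual
  renT : (ℕ → ℕ) → Term → Term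
  renT ρ (var x) = var (ρ x)
  renT ρ (con c) = con c
  renT ρ (fun f ts) = fun f (renTs ρ ts)

  renTs : (ℕ → ℕ) → List Term → List Term
  renTs ρ [] = []
  renTs ρ (t ∷ ts) = renT ρ t ∷ renTs ρ ts

renA : (ℕ → ℕ) → Atom → Atom
renA ρ (atom p ts) = atom p (renTs ρ ts)

ren : (ℕ → ℕ) → Pred → Pred
ren ρ (pos a) = pos (renA ρ a)
ren ρ (neg a) = neg (renA ρ a)
ren ρ ∘ = ∘
ren ρ (all P) = all (ren (ext ρ) P)
ren ρ (ex P) = ex (ren (ext ρ) P)
ren ρ (new P) = new (ren (ext ρ) P)
ren ρ (wen P) = wen (ren (ext ρ) P)
ren ρ (P & Q) = ren ρ P & ren ρ Q
ren ρ (P ⊕ Q) = ren ρ P ⊕ ren ρ Q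
ren ρ (P ∥ Q) = ren ρ P ∥ ren ρ Q
ren ρ (P ⊗ Q) = ren ρ P ⊗ ren ρ Q
ren ρ (P ⨾ Q) = ren ρ P ⨾ ren ρ Q

-- weakening: used for a predicate R placed under a new binder x, which
-- expresses exactly the side condition x # R
wk : Pred → Pred
wk = ren suc

-- swapping the two innermost bound variables (for new x.new y.P ≡ new y.new x.P etc.)
swap01 : ℕ → ℕ
swap01 zero = suc zero
swap01 (suc zero) = zero
swap01 (suc (suc n)) = suc (suc n)

swap : Pred → Pred
swap = ren swap01

exts : (ℕ → Term) → ℕ → Term
exts σ zero = var zero
exts σ (suc n) = renT suc (σ n)

mutual
  subT : (ℕ → Term) → Term → Term
  subT σ (var x) = σ x
  subT σ (con c) = con c
  subT σ (fun f ts) = fun f (subTs σ ts)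

  subTs : (ℕ → Term) → List Term → List Term
  subTs σ [] = []
  subTs σ (t ∷ ts) = subT σ t ∷ subTs σ ts

subA : (ℕ → Term) → Atom → Atom
subA σ (atom p ts) = atom p (subTs σ ts)

sub : (ℕ → Term) → Pred → Pred
sub σ (pos a) = pos (subA σ a)
sub σ (neg a) = neg (subA σ a)
sub σ ∘ = ∘
sub σ (all P) = all (sub (exts σ) P)
sub σ (ex P) = ex (sub (exts σ) P)
sub σ (new P) = new (sub (exts σ) P)
sub σ (wen P) = wen (sub (exts σ) P)
sub σ (P & Q) = sub σ P & sub σ Q
sub σ (P ⊕ Q) = sub σ P ⊕ sub σ Q
sub σ (P ∥ Q) = sub σ P ∥ sub σ Q
sub σ (P ⊗ Q) = sub σ P ⊗ sub σ Q
sub σ (P ⨾ Q) = sub σ P ⨾ sub σ Q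

-- P{v/x} where x is the variable bound by the enclosing binder (index 0)
single : Term → ℕ → Term
single v zero = v
single v (suc n) = var n

_[_] : Pred → Term → Pred
P [ v ] = sub (single v) P

infix 3 _≅_

data _≅_ : Pred → Pred → Set where
  ≅-refl  : ∀ {P} → P ≅ P
  ≅-sym   : ∀ {P Q} → P ≅ Q → Q ≅ P
  ≅-trans : ∀ {P Q R} → P ≅ Q → Q ≅ R → P ≅ R
  ≅-all : ∀ {P P'} → P ≅ P' → all P ≅ all P'
  ≅-ex  : ∀ {P P'} → P ≅ P' → ex P ≅ ex P'
  ≅-new : ∀ {P P'} → P ≅ P' → new P ≅ new P'
  ≅-wen : ∀ {P P'} → P ≅ P' → wen P ≅ wen P'
  ≅-&   : ∀ {P P' Q Q'} → P ≅ P' → Q ≅ Q' → (P & Q) ≅ (P' & Q')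
  ≅-⊕   : ∀ {P P' Q Q'} → P ≅ P' → Q ≅ Q' → (P ⊕ Q) ≅ (P' ⊕ Q')
  ≅-∥   : ∀ {P P' Q Q'} → P ≅ P' → Q ≅ Q' → (P ∥ Q) ≅ (P' ∥ Q')
  ≅-⊗   : ∀ {P P' Q Q'} → P ≅ P' → Q ≅ Q' → (P ⊗ Q) ≅ (P' ⊗ Q')
  ≅-⨾   : ∀ {P P' Q Q'} → P ≅ P' → Q ≅ Q' → (P ⨾ Q) ≅ (P' ⨾ Q')
  ∥-assoc : ∀ {P Q R} → ((P ∥ Q) ∥ R) ≅ (P ∥ (Q ∥ R))
  ∥-comm  : ∀ {P Q} → (P ∥ Q) ≅ (Q ∥ P)
  ∥-unit  : ∀ {P} → (P ∥ ∘) ≅ P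
  ⊗-assoc : ∀ {P Q R} → ((P ⊗ Q) ⊗ R) ≅ (P ⊗ (Q ⊗ R))
  ⊗-comm  : ∀ {P Q} → (P ⊗ Q) ≅ (Q ⊗ P)
  ⊗-unit  : ∀ {P} → (P ⊗ ∘) ≅ P
  ⨾-assoc : ∀ {P Q R} → ((P ⨾ Q) ⨾ R) ≅ (P ⨾ (Q ⨾ R))
  ⨾-unitˡ : ∀ {P} → (∘ ⨾ P) ≅ P
  ⨾-unitʳ : ∀ {P} → (P ⨾ ∘) ≅ P
  new-swap : ∀ {P} → new (new P) ≅ new (new (swap P))
  wen-swap : ∀ {P} → wen (wen P) ≅ wen (wen (swap P))

NonUnit : Pred → Set
NonUnit P = ¬ (P ≅ ∘)

infix 3 _⇒_

data _⇒_ : Pred → Pred → Set where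
  atomic   : ∀ {a} → (neg a ∥ pos a) ⇒ ∘
  switch   : ∀ {P Q S} → NonUnit P → NonUnit Q → NonUnit S →
             (P ∥ (Q ⊗ S)) ⇒ ((P ∥ Q) ⊗ S)
  sequence : ∀ {P Q U V} → NonUnit P → NonUnit Q → NonUnit U → NonUnit V →
             ((P ⨾ Q) ∥ (U ⨾ V)) ⇒ ((P ∥ U) ⨾ (Q ∥ V))
  external : ∀ {P Q S} → NonUnit S →
             ((P & Q) ∥ S) ⇒ ((P ∥ S) & (Q ∥ S))
  tidy     : (∘ & ∘) ⇒ ∘
  medial   : ∀ {P Q U V} → ¬ ((P ≅ ∘) × (U ≅ ∘)) → ¬ ((Q ≅ ∘) × (V ≅ ∘)) →
             ((P ⨾ Q) & (U ⨾ V)) ⇒ ((P & U) ⨾ (Q & V))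
  left     : ∀ {P Q} → (P ⊕ Q) ⇒ P
  right    : ∀ {P Q} → (P ⊕ Q) ⇒ Q
  extrude1 : ∀ {P R} → NonUnit R → (all P ∥ R) ⇒ all (P ∥ wk R)
  tidy1    : all ∘ ⇒ ∘
  medial1  : ∀ {P S} → NonUnit P → NonUnit S →
             all (P ⨾ S) ⇒ (all P ⨾ all S)
  select1  : ∀ {P} (v : Term) → ex P ⇒ P [ v ]
  close    : ∀ {P Q} → (new P ∥ wen Q) ⇒ new (P ∥ Q)
  new-wen  : ∀ {P} → new (wen P) ⇒ wen (new (swap P))
  tidy-name : new ∘ ⇒ ∘
  extrude-new : ∀ {P R} → NonUnit P → NonUnit R →
             (new P ∥ R) ⇒ new (P ∥ wk R)
  fresh    : ∀ {P} → wen P ⇒ new P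
  medial-new : ∀ {P S} → NonUnit P → NonUnit S →
             new (P ⨾ S) ⇒ (new P ⨾ new S)
  medial-wen-∥ : ∀ {P S} → (wen P ∥ wen S) ⇒ wen (P ∥ S)
  medial-wen-⨾ : ∀ {P S} → (wen P ⨾ wen S) ⇒ wen (P ⨾ S)
  left-wen-∥   : ∀ {P R} → NonUnit R → (wen P ∥ R) ⇒ wen (P ∥ wk R)
  left-wen-⨾   : ∀ {P R} → NonUnit R → (wen P ⨾ R) ⇒ wen (P ⨾ wk R)
  right-wen-∥  : ∀ {Q R} → NonUnit R → (R ∥ wen Q) ⇒ wen (wk R ∥ Q)
  right-wen-⨾  : ∀ {Q R} → NonUnit R → (R ⨾ wen Q) ⇒ wen (wk R ⨾ Q)
  all-new    : ∀ {P} → all (new P) ⇒ new (all (swap P))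
  all-wen    : ∀ {P} → all (wen P) ⇒ wen (all (swap P))
  with-new   : ∀ {P S} → (new P & new S) ⇒ new (P & S)
  with-wen   : ∀ {P S} → (wen P & wen S) ⇒ wen (P & S)
  left-new   : ∀ {P R} → (new P & R) ⇒ new (P & wk R)
  left-wen   : ∀ {P R} → (wen P & R) ⇒ wen (P & wk R)
  right-new  : ∀ {Q R} → (R & new Q) ⇒ new (wk R & Q)
  right-wen  : ∀ {Q R} → (R & wen Q) ⇒ wen (wk R & Q)

infix 3 _⟶_

data _⟶_ : Pred → Pred → Set where
  root : ∀ {L R} → L ⇒ R → L ⟶ R
  ⨾ˡ : ∀ {P P' Q} → P ⟶ P' → (P ⨾ Q) ⟶ (P' ⨾ Q)
  ⨾ʳ : ∀ {P Q Q'} → Q ⟶ Q' → (P ⨾ Q) ⟶ (P ⨾ Q')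
  ∥ˡ : ∀ {P P' Q} → P ⟶ P' → (P ∥ Q) ⟶ (P' ∥ Q)
  ∥ʳ : ∀ {P Q Q'} → Q ⟶ Q' → (P ∥ Q) ⟶ (P ∥ Q')
  ⊗ˡ : ∀ {P P' Q} → P ⟶ P' → (P ⊗ Q) ⟶ (P' ⊗ Q)
  ⊗ʳ : ∀ {P Q Q'} → Q ⟶ Q' → (P ⊗ Q) ⟶ (P ⊗ Q')
  &ˡ : ∀ {P P' Q} → P ⟶ P' → (P & Q) ⟶ (P' & Q)
  &ʳ : ∀ {P Q Q'} → Q ⟶ Q' → (P & Q) ⟶ (P & Q')
  ⊕ˡ : ∀ {P P' Q} → P ⟶ P' → (P ⊕ Q) ⟶ (P' ⊕ Q)
  ⊕ʳ : ∀ {P Q Q'} → Q ⟶ Q' → (P ⊕ Q) ⟶ (P ⊕ Q')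
  in-all : ∀ {P P'} → P ⟶ P' → all P ⟶ all P'
  in-ex  : ∀ {P P'} → P ⟶ P' → ex P ⟶ ex P'
  in-new : ∀ {P P'} → P ⟶ P' → new P ⟶ new P'
  in-wen : ∀ {P P'} → P ⟶ P' → wen P ⟶ wen P'

infix 3 _⟶*_

data _⟶*_ : Pred → Pred → Set where
  done : ∀ {P} → P ⟶* P
  step : ∀ {P Q R} → P ⟶ Q → Q ⟶* R → P ⟶* R
  cong : ∀ {P Q R} → P ≅ Q → Q ⟶* R → P ⟶* R

⊢_ : Pred → Set
⊢ P = P ⟶* ∘

-- Induction on P. Each connective meets its dual through the matching interaction
-- rule (atomic, switch, sequence, external + left/right, extrude1 + select1, close),
-- after which the induction hypotheses close the premises. The side conditions of
-- switch and sequence are met because P ≅ ∘ is decidable and dual P ≅ ∘ exactly when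
-- P ≅ ∘; in the degenerate case the unit is simply dropped up to ≅.
module Submission where

open import Defs
open import Data.Nat using (zero; suc)
open import Data.List using ([]; _∷_)
open import Data.Bool using (Bool; true; false; _∧_)
open import Data.Bool.Properties using (∧-assoc; ∧-comm; ∧-identityʳ)
open import Data.Product using (_×_; _,_)
open import Data.Sum using (_⊎_; inj₁; inj₂)
open import Relation.Binary.PropositionalEquality as Eq using (_≡_; refl; cong₂)

∥-unitˡ : ∀ {P} → (∘ ∥ P) ≅ P
∥-unitˡ = ≅-trans ∥-comm ∥-unit

⊗-unitˡ : ∀ {P} → (∘ ⊗ P) ≅ P
⊗-unitˡ = ≅-trans ⊗-comm ⊗-unit

isUnit : Pred → Bool
isUnit ∘ = true
isUnit (P ∥ Q) = isUnit P ∧ isUnit Q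
isUnit (P ⊗ Q) = isUnit P ∧ isUnit Q
isUnit (P ⨾ Q) = isUnit P ∧ isUnit Q
isUnit _ = false

isUnit-resp-≅ : ∀ {P Q} → P ≅ Q → isUnit P ≡ isUnit Q
isUnit-resp-≅ ≅-refl = refl
isUnit-resp-≅ (≅-sym e) = Eq.sym (isUnit-resp-≅ e)
isUnit-resp-≅ (≅-trans e f) = Eq.trans (isUnit-resp-≅ e) (isUnit-resp-≅ f)
isUnit-resp-≅ (≅-all e) = refl
isUnit-resp-≅ (≅-ex e) = refl
isUnit-resp-≅ (≅-new e) = refl
isUnit-resp-≅ (≅-wen e) = refl
isUnit-resp-≅ (≅-& e f) = refl
isUnit-resp-≅ (≅-⊕ e f) = refl
isUnit-resp-≅ (≅-∥ e f) = cong₂ _∧_ (isUnit-resp-≅ e) (isUnit-resp-≅ f)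
isUnit-resp-≅ (≅-⊗ e f) = cong₂ _∧_ (isUnit-resp-≅ e) (isUnit-resp-≅ f)
isUnit-resp-≅ (≅-⨾ e f) = cong₂ _∧_ (isUnit-resp-≅ e) (isUnit-resp-≅ f)
isUnit-resp-≅ (∥-assoc {P} {Q} {R}) = ∧-assoc (isUnit P) (isUnit Q) (isUnit R)
isUnit-resp-≅ (∥-comm {P} {Q}) = ∧-comm (isUnit P) (isUnit Q)
isUnit-resp-≅ (∥-unit {P}) = ∧-identityʳ (isUnit P)
isUnit-resp-≅ (⊗-assoc {P} {Q} {R}) = ∧-assoc (isUnit P) (isUnit Q) (isUnit R)
isUnit-resp-≅ (⊗-comm {P} {Q}) = ∧-comm (isUnit P) (isUnit Q)
isUnit-resp-≅ (⊗-unit {P}) = ∧-identityʳ (isUnit P)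
isUnit-resp-≅ (⨾-assoc {P} {Q} {R}) = ∧-assoc (isUnit P) (isUnit Q) (isUnit R)
isUnit-resp-≅ ⨾-unitˡ = refl
isUnit-resp-≅ (⨾-unitʳ {P}) = ∧-identityʳ (isUnit P)
isUnit-resp-≅ new-swap = refl
isUnit-resp-≅ wen-swap = refl

isUnit-dual : ∀ P → isUnit (dual P) ≡ isUnit P
isUnit-dual (P ∥ Q) = cong₂ _∧_ (isUnit-dual P) (isUnit-dual Q)
isUnit-dual (P ⊗ Q) = cong₂ _∧_ (isUnit-dual P) (isUnit-dual Q)
isUnit-dual (P ⨾ Q) = cong₂ _∧_ (isUnit-dual P) (isUnit-dual Q)
isUnit-dual (pos _) = refl
isUnit-dual (neg _) = refl
isUnit-dual ∘ = refl
isUnit-dual (all _) = refl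
isUnit-dual (ex _) = refl
isUnit-dual (new _) = refl
isUnit-dual (wen _) = refl
isUnit-dual (_ & _) = refl
isUnit-dual (_ ⊕ _) = refl

isUnit⇒≅∘ : ∀ P → isUnit P ≡ true → P ≅ ∘
isUnit⇒≅∘ ∘ _ = ≅-refl
isUnit⇒≅∘ (P ∥ Q) h with isUnit P in p | isUnit Q in q
... | true | true = ≅-trans (≅-∥ (isUnit⇒≅∘ P p) (isUnit⇒≅∘ Q q)) ∥-unit
isUnit⇒≅∘ (P ⊗ Q) h with isUnit P in p | isUnit Q in q
... | true | true = ≅-trans (≅-⊗ (isUnit⇒≅∘ P p) (isUnit⇒≅∘ Q q)) ⊗-unit
isUnit⇒≅∘ (P ⨾ Q) h with isUnit P in p | isUnit Q in q
... | true | true = ≅-trans (≅-⨾ (isUnit⇒≅∘ P p) (isUnit⇒≅∘ Q q)) ⨾-unitʳ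

¬isUnit⇒NonUnit : ∀ P → isUnit P ≡ false → NonUnit P
¬isUnit⇒NonUnit P h e with Eq.trans (Eq.sym h) (isUnit-resp-≅ e)
... | ()

unit-dichotomy : ∀ P → ((P ≅ ∘) × (dual P ≅ ∘)) ⊎ (NonUnit P × NonUnit (dual P))
unit-dichotomy P with isUnit P in eq
... | true  = inj₁ (isUnit⇒≅∘ P eq , isUnit⇒≅∘ (dual P) (Eq.trans (isUnit-dual P) eq))
... | false = inj₂ (¬isUnit⇒NonUnit P eq
                   , ¬isUnit⇒NonUnit (dual P) (Eq.trans (isUnit-dual P) eq))

mutual
  subT-renT-cancel : ∀ {σ ρ} → (∀ n → σ (ρ n) ≡ var n) → ∀ t → subT σ (renT ρ t) ≡ t
  subT-renT-cancel h (var x) = h x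
  subT-renT-cancel h (con c) = refl
  subT-renT-cancel h (fun f ts) = Eq.cong (fun f) (subTs-renTs-cancel h ts)

  subTs-renTs-cancel : ∀ {σ ρ} → (∀ n → σ (ρ n) ≡ var n) → ∀ ts → subTs σ (renTs ρ ts) ≡ ts
  subTs-renTs-cancel h [] = refl
  subTs-renTs-cancel h (t ∷ ts) = cong₂ _∷_ (subT-renT-cancel h t) (subTs-renTs-cancel h ts)

subA-renA-cancel : ∀ {σ ρ} → (∀ n → σ (ρ n) ≡ var n) → ∀ a → subA σ (renA ρ a) ≡ a
subA-renA-cancel h (atom p ts) = Eq.cong (atom p) (subTs-renTs-cancel h ts)

exts-ext-cancel : ∀ {σ ρ} → (∀ n → σ (ρ n) ≡ var n) → ∀ n → exts σ (ext ρ n) ≡ var n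
exts-ext-cancel h zero = refl
exts-ext-cancel h (suc n) = Eq.cong (renT suc) (h n)

sub-ren-cancel : ∀ {σ ρ} → (∀ n → σ (ρ n) ≡ var n) → ∀ P → sub σ (ren ρ P) ≡ P
sub-ren-cancel h (pos a) = Eq.cong pos (subA-renA-cancel h a)
sub-ren-cancel h (neg a) = Eq.cong neg (subA-renA-cancel h a)
sub-ren-cancel h ∘ = refl
sub-ren-cancel h (all P) = Eq.cong all (sub-ren-cancel (exts-ext-cancel h) P)
sub-ren-cancel h (ex P) = Eq.cong ex (sub-ren-cancel (exts-ext-cancel h) P)
sub-ren-cancel h (new P) = Eq.cong new (sub-ren-cancel (exts-ext-cancel h) P)
sub-ren-cancel h (wen P) = Eq.cong wen (sub-ren-cancel (exts-ext-cancel h) P)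
sub-ren-cancel h (P & Q) = cong₂ _&_ (sub-ren-cancel h P) (sub-ren-cancel h Q)
sub-ren-cancel h (P ⊕ Q) = cong₂ _⊕_ (sub-ren-cancel h P) (sub-ren-cancel h Q)
sub-ren-cancel h (P ∥ Q) = cong₂ _∥_ (sub-ren-cancel h P) (sub-ren-cancel h Q)
sub-ren-cancel h (P ⊗ Q) = cong₂ _⊗_ (sub-ren-cancel h P) (sub-ren-cancel h Q)
sub-ren-cancel h (P ⨾ Q) = cong₂ _⨾_ (sub-ren-cancel h P) (sub-ren-cancel h Q)

-- Instantiating a weakened ∃ (ex P lifted under one more binder) with the newly
-- bound variable undoes the weakening.
select-weakened : ∀ P → wk (ex P) ⟶ P
select-weakened P = Eq.subst (wk (ex P) ⟶_) (sub-ren-cancel single-ext-suc P)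
                      (root (select1 (var zero)))
  where
  single-ext-suc : ∀ n → single (var zero) (ext suc n) ≡ var n
  single-ext-suc zero = refl
  single-ext-suc (suc n) = refl

infixr 5 _◅◅_

_◅◅_ : ∀ {P Q R} → P ⟶* Q → Q ⟶* R → P ⟶* R
done ◅◅ d = d
step s d ◅◅ e = step s (d ◅◅ e)
cong c d ◅◅ e = cong c (d ◅◅ e)

⟶*-map : (f : Pred → Pred) → (∀ {P Q} → P ⟶ Q → f P ⟶ f Q) → (∀ {P Q} → P ≅ Q → f P ≅ f Q) →
         ∀ {P Q} → P ⟶* Q → f P ⟶* f Q
⟶*-map f g h done = done
⟶*-map f g h (step s d) = step (g s) (⟶*-map f g h d)
⟶*-map f g h (cong c d) = cong (h c) (⟶*-map f g h d)

∥ʳ* : ∀ {P Q} R → P ⟶* Q → (R ∥ P) ⟶* (R ∥ Q)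
∥ʳ* R = ⟶*-map (R ∥_) ∥ʳ (≅-∥ ≅-refl)

⊗ˡ* : ∀ {P Q} R → P ⟶* Q → (P ⊗ R) ⟶* (Q ⊗ R)
⊗ˡ* R = ⟶*-map (_⊗ R) ⊗ˡ (λ c → ≅-⊗ c ≅-refl)

⨾ˡ* : ∀ {P Q} R → P ⟶* Q → (P ⨾ R) ⟶* (Q ⨾ R)
⨾ˡ* R = ⟶*-map (_⨾ R) ⨾ˡ (λ c → ≅-⨾ c ≅-refl)

⨾ʳ* : ∀ {P Q} R → P ⟶* Q → (R ⨾ P) ⟶* (R ⨾ Q)
⨾ʳ* R = ⟶*-map (R ⨾_) ⨾ʳ (≅-⨾ ≅-refl)

&ˡ* : ∀ {P Q} R → P ⟶* Q → (P & R) ⟶* (Q & R)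
&ˡ* R = ⟶*-map (_& R) &ˡ (λ c → ≅-& c ≅-refl)

&ʳ* : ∀ {P Q} R → P ⟶* Q → (R & P) ⟶* (R & Q)
&ʳ* R = ⟶*-map (R &_) &ʳ (≅-& ≅-refl)

in-all* : ∀ {P Q} → P ⟶* Q → all P ⟶* all Q
in-all* = ⟶*-map all in-all ≅-all

in-new* : ∀ {P Q} → P ⟶* Q → new P ⟶* new Q
in-new* = ⟶*-map new in-new ≅-new

⊢-∥-comm : ∀ {P Q} → ⊢ (P ∥ Q) → ⊢ (Q ∥ P)
⊢-∥-comm = cong ∥-comm

⊢-all-ex : ∀ {P Q} → ⊢ (P ∥ Q) → ⊢ (all P ∥ ex Q)
⊢-all-ex {Q = Q} ⊢P∥Q =
  step (root (extrude1 (¬isUnit⇒NonUnit (ex Q) refl)))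
    (step (in-all (∥ʳ (select-weakened Q)))
      (in-all* ⊢P∥Q ◅◅ step (root tidy1) done))

⊢-new-wen : ∀ {P Q} → ⊢ (P ∥ Q) → ⊢ (new P ∥ wen Q)
⊢-new-wen ⊢P∥Q = step (root close) (in-new* ⊢P∥Q ◅◅ step (root tidy-name) done)

⊢-&-⊕ : ∀ {P Q R S} → ⊢ (P ∥ R) → ⊢ (Q ∥ S) → ⊢ ((P & Q) ∥ (R ⊕ S))
⊢-&-⊕ {Q = Q} {R} {S} ⊢P∥R ⊢Q∥S =
  step (root (external (¬isUnit⇒NonUnit (R ⊕ S) refl)))
    (step (&ˡ (∥ʳ (root left))) (step (&ʳ (∥ʳ (root right)))
      (&ˡ* (Q ∥ S) ⊢P∥R ◅◅ &ʳ* ∘ ⊢Q∥S ◅◅ step (root tidy) done)))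

⊢-∥-⊗ : ∀ {P Q R S} → NonUnit Q → NonUnit R → NonUnit S →
        ⊢ (P ∥ R) → ⊢ (Q ∥ S) → ⊢ ((P ∥ Q) ∥ (R ⊗ S))
⊢-∥-⊗ {P} {R = R} Q≇∘ R≇∘ S≇∘ ⊢P∥R ⊢Q∥S =
  cong (≅-trans ∥-assoc (≅-∥ ≅-refl (≅-∥ ≅-refl ⊗-comm)))
    (step (∥ʳ (root (switch Q≇∘ S≇∘ R≇∘)))
      (∥ʳ* P (⊗ˡ* R ⊢Q∥S) ◅◅ cong (≅-∥ ≅-refl ⊗-unitˡ) ⊢P∥R))

⊢-⨾-⨾ : ∀ {P Q R S} → NonUnit P → NonUnit Q → NonUnit R → NonUnit S →
        ⊢ (P ∥ R) → ⊢ (Q ∥ S) → ⊢ ((P ⨾ Q) ∥ (R ⨾ S))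
⊢-⨾-⨾ {Q = Q} {S = S} P≇∘ Q≇∘ R≇∘ S≇∘ ⊢P∥R ⊢Q∥S =
  step (root (sequence P≇∘ Q≇∘ R≇∘ S≇∘))
    (⨾ˡ* (Q ∥ S) ⊢P∥R ◅◅ ⨾ʳ* ∘ ⊢Q∥S ◅◅ cong ⨾-unitˡ done)

identity-∥ : ∀ P Q → ⊢ (dual P ∥ P) → ⊢ (dual Q ∥ Q) → ⊢ (dual (P ∥ Q) ∥ (P ∥ Q))
identity-∥ P Q ⊢P ⊢Q with unit-dichotomy P | unit-dichotomy Q
... | inj₁ (P≅∘ , P̄≅∘) | _ =
  cong (≅-∥ (≅-trans (≅-⊗ P̄≅∘ ≅-refl) ⊗-unitˡ) (≅-trans (≅-∥ P≅∘ ≅-refl) ∥-unitˡ)) ⊢Q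
... | inj₂ _ | inj₁ (Q≅∘ , Q̄≅∘) =
  cong (≅-∥ (≅-trans (≅-⊗ ≅-refl Q̄≅∘) ⊗-unit) (≅-trans (≅-∥ ≅-refl Q≅∘) ∥-unit)) ⊢P
... | inj₂ (_ , P̄≇∘) | inj₂ (Q≇∘ , Q̄≇∘) =
  ⊢-∥-comm (⊢-∥-⊗ Q≇∘ P̄≇∘ Q̄≇∘ (⊢-∥-comm ⊢P) (⊢-∥-comm ⊢Q))

identity-⊗ : ∀ P Q → ⊢ (dual P ∥ P) → ⊢ (dual Q ∥ Q) → ⊢ (dual (P ⊗ Q) ∥ (P ⊗ Q))
identity-⊗ P Q ⊢P ⊢Q with unit-dichotomy P | unit-dichotomy Q
... | inj₁ (P≅∘ , P̄≅∘) | _ =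
  cong (≅-∥ (≅-trans (≅-∥ P̄≅∘ ≅-refl) ∥-unitˡ) (≅-trans (≅-⊗ P≅∘ ≅-refl) ⊗-unitˡ)) ⊢Q
... | inj₂ _ | inj₁ (Q≅∘ , Q̄≅∘) =
  cong (≅-∥ (≅-trans (≅-∥ ≅-refl Q̄≅∘) ∥-unit) (≅-trans (≅-⊗ ≅-refl Q≅∘) ⊗-unit)) ⊢P
... | inj₂ (P≇∘ , _) | inj₂ (Q≇∘ , Q̄≇∘) = ⊢-∥-⊗ Q̄≇∘ P≇∘ Q≇∘ ⊢P ⊢Q

identity-⨾ : ∀ P Q → ⊢ (dual P ∥ P) → ⊢ (dual Q ∥ Q) → ⊢ (dual (P ⨾ Q) ∥ (P ⨾ Q))
identity-⨾ P Q ⊢P ⊢Q with unit-dichotomy P | unit-dichotomy Q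
... | inj₁ (P≅∘ , P̄≅∘) | _ =
  cong (≅-∥ (≅-trans (≅-⨾ P̄≅∘ ≅-refl) ⨾-unitˡ) (≅-trans (≅-⨾ P≅∘ ≅-refl) ⨾-unitˡ)) ⊢Q
... | inj₂ _ | inj₁ (Q≅∘ , Q̄≅∘) =
  cong (≅-∥ (≅-trans (≅-⨾ ≅-refl Q̄≅∘) ⨾-unitʳ) (≅-trans (≅-⨾ ≅-refl Q≅∘) ⨾-unitʳ)) ⊢P
... | inj₂ (P≇∘ , P̄≇∘) | inj₂ (Q≇∘ , Q̄≇∘) = ⊢-⨾-⨾ P̄≇∘ Q̄≇∘ P≇∘ Q≇∘ ⊢P ⊢Q

proposition3p2 : (P : Pred) → ⊢ (dual P ∥ P)
proposition3p2 (pos a) = step (root atomic) done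
proposition3p2 (neg a) = ⊢-∥-comm (step (root atomic) done)
proposition3p2 ∘ = cong ∥-unit done
proposition3p2 (all P) = ⊢-∥-comm (⊢-all-ex (⊢-∥-comm (proposition3p2 P)))
proposition3p2 (ex P) = ⊢-all-ex (proposition3p2 P)
proposition3p2 (new P) = ⊢-∥-comm (⊢-new-wen (⊢-∥-comm (proposition3p2 P)))
proposition3p2 (wen P) = ⊢-new-wen (proposition3p2 P)
proposition3p2 (P & Q) =
  ⊢-∥-comm (⊢-&-⊕ (⊢-∥-comm (proposition3p2 P)) (⊢-∥-comm (proposition3p2 Q)))
proposition3p2 (P ⊕ Q) = ⊢-&-⊕ (proposition3p2 P) (proposition3p2 Q)
proposition3p2 (P ∥ Q) = identity-∥ P Q (proposition3p2 P) (proposition3p2 Q)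
proposition3p2 (P ⊗ Q) = identity-⊗ P Q (proposition3p2 P) (proposition3p2 Q)
proposition3p2 (P ⨾ Q) = identity-⨾ P Q (proposition3p2 P) (proposition3p2 Q)
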